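{- Let $A:\mathsf{Type}$ and $B:A\to\mathsf{Type}$. The following are equivalent: (1) $\Sigma\text{ -isolate}_{A,B}$ is an equivalence; (2) $\Sigma\text{ -isolate}_{A,B}$ is a surjection; (3) for all $a:A$ and $b:B(a)$, if $(a,b)$ is isolated in $\sum_{a:A}B(a)$, then both $a$ and $b$ are isolated.
   Context: Work in Homotopy Type Theory with a univalent universe. A point $a:A$ is isolated if $a=b$ is decidable for all $b:A$; $A^{\circ}$ is the subtype of isolated points. The map $\Sigma\text{ -isolate}_{A,B}:\sum_{a:A^{\circ}}(B(a))^{\circ}\to(\sum_{a:A}B(a))^{\circ}$ sends a pair of isolated points $(a,b)$ to $(a,b)$, which is isolated in the $\Sigma$-type. A map is a surjection if all its fibers are merely inhabited. -}

{-# OPTIONS --without-K #-}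
module Defs where

open import Level using (Level; _⊔_; suc)
open import Data.Empty using (⊥-elim)
open import Data.Product using (Σ; _,_; proj₁; proj₂)
open import Relation.Nullary using (Dec; yes; no; ¬_)
open import Relation.Binary.PropositionalEquality
  using (_≡_; refl; sym; trans; cong; subst; trans-symˡ)

private
  variable
    ℓ ℓ' : Level

isContr : Set ℓ → Set ℓ
isContr X = Σ X λ c → ∀ x → c ≡ x

isProp : Set ℓ → Set ℓ
isProp X = (x y : X) → x ≡ y

fiber : {X : Set ℓ} {Y : Set ℓ'} → (X → Y) → Y → Set (ℓ ⊔ ℓ')
fiber {X = X} f y = Σ X λ x → f x ≡ y

isEquiv : {X : Set ℓ} {Y : Set ℓ'} → (X → Y) → Set (ℓ ⊔ ℓ')
isEquiv {Y = Y} f = (y : Y) → isContr (fiber f y)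

-- propositional truncation (mere inhabitation), impredicative encoding
∥_∥ : Set ℓ → Set (suc ℓ)
∥_∥ {ℓ} X = (P : Set ℓ) → isProp P → (X → P) → P

isSurjection : {X : Set ℓ} {Y : Set ℓ'} → (X → Y) → Set (suc (ℓ ⊔ ℓ'))
isSurjection {Y = Y} f = (y : Y) → ∥ fiber f y ∥

isIsolated : {A : Set ℓ} → A → Set ℓ
isIsolated {A = A} a = (b : A) → Dec (a ≡ b)

_° : Set ℓ → Set ℓ
A ° = Σ A isIsolated

-- local Hedberg: loops at an isolated point are trivial
module _ {A : Set ℓ} {a : A} (dec : isIsolated a) where
  private
    norm : ∀ {x} → a ≡ x → a ≡ x
    norm {x} p with dec x
    ... | yes q = q
    ... | no ¬q = ⊥-elim (¬q p)

    norm-const : ∀ {x} (p q : a ≡ x) → norm p ≡ norm q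
    norm-const {x} p q with dec x
    ... | yes _ = refl
    ... | no ¬q = ⊥-elim (¬q p)

    norm-left : ∀ {x} (p : a ≡ x) → trans (sym (norm refl)) (norm p) ≡ p
    norm-left refl = trans-symˡ (norm refl)

  isolated-loop : (p : a ≡ a) → p ≡ refl
  isolated-loop p =
    trans (sym (norm-left p))
      (trans (cong (trans (sym (norm refl))) (norm-const p refl))
             (norm-left refl))

private
  Σ-≡-snd : {A : Set ℓ} {B : A → Set ℓ'} {a a' : A} {b : B a} {b' : B a'}
            (r : (a , b) ≡ (a' , b')) → subst B (cong proj₁ r) b ≡ b'
  Σ-≡-snd refl = refl

Σ-isolated : {A : Set ℓ} {B : A → Set ℓ'} {a : A} {b : B a} →
             isIsolated a → isIsolated b → isIsolated {A = Σ A B} (a , b)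
Σ-isolated {B = B} {a = a} {b = b} i j (a' , b') with i a'
... | no ¬p = no λ r → ¬p (cong proj₁ r)
... | yes refl with j b'
...   | yes refl = yes refl
...   | no ¬q = no λ r →
          ¬q (subst (λ e → subst B e b ≡ b') (isolated-loop i (cong proj₁ r))
                    (Σ-≡-snd r))

Σ-isolate : (A : Set ℓ) (B : A → Set ℓ') →
            Σ (A °) (λ a → (B (proj₁ a)) °) → (Σ A B) °
Σ-isolate A B ((a , i) , (b , j)) = (a , b) , Σ-isolated i j

{-# OPTIONS --without-K #-}
module Submission where

-- An isolated point has propositional path spaces (local Hedberg), so with
-- function extensionality "being isolated" is a proposition and A° is a set.
-- Hence Σ-isolate, which only forgets the isolation witnesses, is injective
-- into a set and its fibers are propositions: it is an equivalence exactly
-- when it is surjective. Its fiber over an isolated pair (a , b) is inhabited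
-- exactly when a and b are themselves isolated, and for a proposition being
-- inhabited and being merely inhabited coincide.

open import Defs
open import Level using (Level; _⊔_)
open import Data.Product using (Σ; _×_; _,_; proj₁; proj₂)
open import Data.Empty using (⊥-elim)
open import Function.Base using (id)
open import Function.Bundles using (_⇔_; mk⇔)
open import Axiom.Extensionality.Propositional using (Extensionality)
open import Relation.Nullary using (Dec; yes; no)
open import Relation.Binary.PropositionalEquality
  using (_≡_; refl; sym; trans; cong; cong₂)

private
  variable
    ℓ ℓ' : Level

isSet : Set ℓ → Set ℓ
isSet X = (x y : X) → isProp (x ≡ y)

×-isProp : {X : Set ℓ} {Y : Set ℓ'} → isProp X → isProp Y → isProp (X × Y)
×-isProp pX pY (x , y) (x' , y') = cong₂ _,_ (pX x x') (pY y y')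

isolated-≡-isProp : {A : Set ℓ} {a x : A} → isIsolated a → isProp (a ≡ x)
isolated-≡-isProp i p refl = isolated-loop i p

isEquiv⇒isSurjection : {X : Set ℓ} {Y : Set ℓ'} {f : X → Y} →
                       isEquiv f → isSurjection f
isEquiv⇒isSurjection e y _ _ g = g (proj₁ (e y))

isSurjection⇒isEquiv : {X : Set ℓ} {Y : Set ℓ'} {f : X → Y} →
                       (∀ y → isProp (fiber f y)) → isSurjection f → isEquiv f
isSurjection⇒isEquiv {f = f} fiber-isProp s y =
  let c = s y (fiber f y) (fiber-isProp y) id in c , fiber-isProp y c

injective⇒fiber-isProp : {X : Set ℓ} {Y : Set ℓ'} {f : X → Y} → isSet Y →
                         (∀ {x x'} → f x ≡ f x' → x ≡ x') →
                         ∀ y → isProp (fiber f y)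
injective⇒fiber-isProp Y-isSet inj y (x , p) (x' , p')
  with inj (trans p (sym p'))
... | refl = cong (x ,_) (Y-isSet _ y p p')

module _ (funext : ∀ {a b} → Extensionality a b) where

  Dec-isProp : {X : Set ℓ} → isProp X → isProp (Dec X)
  Dec-isProp pX (yes p) (yes q) = cong yes (pX p q)
  Dec-isProp pX (yes p) (no ¬q) = ⊥-elim (¬q p)
  Dec-isProp pX (no ¬p) (yes q) = ⊥-elim (¬p q)
  Dec-isProp pX (no ¬p) (no ¬q) = cong no (funext λ p → ⊥-elim (¬p p))

  isIsolated-isProp : {A : Set ℓ} {a : A} → isProp (isIsolated a)
  isIsolated-isProp i i' =
    funext λ x → Dec-isProp (isolated-≡-isProp i) (i x) (i' x)

  °-isolated : {A : Set ℓ} (a : A °) → isIsolated a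
  °-isolated (a , i) (a' , i') with i a'
  ... | yes refl = yes (cong (a ,_) (isIsolated-isProp i i'))
  ... | no a≢a'  = no λ r → a≢a' (cong proj₁ r)

  °-isSet : (A : Set ℓ) → isSet (A °)
  °-isSet A a _ = isolated-≡-isProp (°-isolated a)

  module _ (A : Set ℓ) (B : A → Set ℓ') where

    Components-isolated : Set (ℓ ⊔ ℓ')
    Components-isolated = (a : A) (b : B a) →
      isIsolated {A = Σ A B} (a , b) → isIsolated a × isIsolated b

    Σ-isolate-injective : ∀ {x x'} → Σ-isolate A B x ≡ Σ-isolate A B x' → x ≡ x'
    Σ-isolate-injective {(a , i) , (b , j)} {(a' , i') , (b' , j')} e
      with cong proj₁ e
    ... | refl = cong₂ (λ i j → (a , i) , (b , j))
                       (isIsolated-isProp i i') (isIsolated-isProp j j')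

    Σ-isolate-fiber-isProp : ∀ y → isProp (fiber (Σ-isolate A B) y)
    Σ-isolate-fiber-isProp =
      injective⇒fiber-isProp (°-isSet (Σ A B)) Σ-isolate-injective

    isSurjection⇒components-isolated :
      isSurjection (Σ-isolate A B) → Components-isolated
    isSurjection⇒components-isolated s a b k =
      s ((a , b) , k) _ (×-isProp isIsolated-isProp isIsolated-isProp) components
      where
      components : fiber (Σ-isolate A B) ((a , b) , k) → isIsolated a × isIsolated b
      components (((_ , i) , (_ , j)) , refl) = i , j

    components-isolated⇒isSurjection :
      Components-isolated → isSurjection (Σ-isolate A B)
    components-isolated⇒isSurjection h ((a , b) , k) _ _ g =
      let (i , j) = h a b k in
      g (((a , i) , (b , j)) , cong ((a , b) ,_) (isIsolated-isProp _ k))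

lemma2p13 : (funext : ∀ {a b} → Extensionality a b)
            {ℓ ℓ' : Level} (A : Set ℓ) (B : A → Set ℓ') →
            (isEquiv (Σ-isolate A B) ⇔ isSurjection (Σ-isolate A B))
            × (isSurjection (Σ-isolate A B)
               ⇔ ((a : A) (b : B a) → isIsolated {A = Σ A B} (a , b) → isIsolated a × isIsolated b))
lemma2p13 funext A B =
  mk⇔ isEquiv⇒isSurjection
      (isSurjection⇒isEquiv (Σ-isolate-fiber-isProp funext A B)) ,
  mk⇔ (isSurjection⇒components-isolated funext A B)
      (components-isolated⇒isSurjection funext A B)
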